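{- For all positive integers $m,n$, $$\sum_{k=1}^n \binom{2n}{n-k} k^{2m} = \sum_{\ell=0}^m (-1)^\ell\, 2^{2n-2\ell-1}\, \langle 2n\rangle_{2\ell}\, \sigma_{m,\ell}(n).$$
   Context: Falling factorial: $\langle x\rangle_0=1$ and $\langle x\rangle_j = x(x-1)\cdots(x-j+1)$ for positive integers $j$. For nonnegative integers $\ell\le m$ and an indeterminate $y$, $\sigma_{m,\ell}(y)$ denotes the coefficient of $T^{m-\ell}$ in the formal power series $\prod_{j=0}^{\ell} \frac{1}{1-T(y-j)^2}$; equivalently $\sigma_{m,\ell}(y)=\sum_{0\le k_1\le k_2\le\cdots\le k_{m-\ell}\le \ell}\prod_{i=1}^{m-\ell}(y-k_i)^2$ (the complete homogeneous symmetric polynomial of degree $m-\ell$ in $y^2,(y-1)^2,\dots,(y-\ell)^2$). -}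

module Defs where

open import Data.Nat as ℕ using (ℕ; zero; suc; _∸_)
open import Data.Integer as ℤ using (ℤ; +_; -[1+_])
open import Data.Rational using (ℚ; _+_; _*_; _-_; -_; 0ℚ; 1ℚ; _/_)
open import Data.List using (List; []; _∷_; map; upTo)

ℤtoℚ : ℤ → ℚ
ℤtoℚ z = z / 1

ℕtoℚ : ℕ → ℚ
ℕtoℚ n = ℤtoℚ (+ n)

sumTo : ℕ → (ℕ → ℚ) → ℚ
sumTo zero    f = 0ℚ
sumTo (suc n) f = sumTo n f + f n

_^ℚ_ : ℚ → ℕ → ℚ
x ^ℚ zero  = 1ℚ
x ^ℚ suc k = x * (x ^ℚ k)

pow2 : ℤ → ℚ
pow2 (+ k)      = ℕtoℚ 2 ^ℚ k
pow2 -[1+ k ]   = ((+ 1) / 2) ^ℚ suc k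

-- falling factorial ⟨x⟩_j = x(x-1)...(x-j+1), ⟨x⟩_0 = 1
falling : ℚ → ℕ → ℚ
falling x zero    = 1ℚ
falling x (suc j) = falling x j * (x - ℕtoℚ j)

-- complete homogeneous symmetric polynomial h_d(x₁,…,x_k) of degree d
-- (sum over all multisets of size d of the product), via the standard
-- recursion h_d(x ∷ xs) = h_d(xs) + x · h_{d-1}(x ∷ xs).
hcomp : ℕ → List ℚ → ℚ
hcomp zero    _        = 1ℚ
hcomp (suc d) []       = 0ℚ
hcomp (suc d) (x ∷ xs) = hcomp (suc d) xs + x * hcomp d (x ∷ xs)

-- σ_{m,ℓ}(y) = h_{m-ℓ}(y², (y-1)², …, (y-ℓ)²)   (used for ℓ ≤ m)
σ : ℕ → ℕ → ℚ → ℚ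
σ m ℓ y = hcomp (m ∸ ℓ) (map (λ j → (y - ℕtoℚ j) * (y - ℕtoℚ j)) (upTo (suc ℓ)))

sign : ℕ → ℚ
sign ℓ = (- 1ℚ) ^ℚ ℓ

module Submission where

-- Newton interpolation of x ↦ x ^ m at the nodes a_j = (n − j)² reads
-- x ^ m = Σ_ℓ h_{m−ℓ}(a₀, …, a_ℓ) · ∏_{j<ℓ} (x − a_j), and the coefficient is σ_{m,ℓ}(n).
-- At the node x = a_i the product factors as (−1)^ℓ ⟨i⟩_ℓ ⟨2n − i⟩_ℓ, so weighting by C(2n, i)
-- and using Σ_i C(N, i) ⟨i⟩_ℓ ⟨N − i⟩_ℓ = ⟨N⟩_{2ℓ} 2^{N − 2ℓ} (absorption, induction on ℓ)
-- turns the central moment Σ_i C(2n, i) (n − i)^{2m} into twice the right-hand side.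
-- By the symmetry of the binomial row, the same moment is twice the left-hand side.

open import Defs
open import Data.Nat as ℕ using (ℕ; zero; suc; _∸_; _≤_; _<_; z≤n; s≤s)
import Data.Nat.Properties as ℕP
open import Data.Nat.Combinatorics
  using (_C_; nC1≡n; nCk≡nC[n∸k]; k>n⇒nCk≡0; nCk+nC[k+1]≡[n+1]C[k+1])
import Data.Nat.Coprimality as Coprime
open import Data.Integer as ℤ using (+_; -[1+_])
import Data.Integer.Properties as ℤP
open import Data.Rational using (ℚ; mkℚ; _+_; _*_; _-_; -_; 0ℚ; 1ℚ; _/_)
import Data.Rational.Properties as ℚP
open import Data.Rational.Solver using (module +-*-Solver)
open import Data.List using (List; []; _∷_; _++_; [_]; map; upTo)
import Data.List.Properties as ListP
open import Data.Sum using (inj₁; inj₂)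
open import Relation.Binary.PropositionalEquality hiding ([_])
open ≡-Reasoning
open +-*-Solver

ℕtoℚ≡mkℚ : ∀ n → ℕtoℚ n ≡ mkℚ (+ n) 0 (Coprime.sym (Coprime.1-coprimeTo n))
ℕtoℚ≡mkℚ n = ℚP.normalize-coprime (Coprime.sym (Coprime.1-coprimeTo n))

ℕtoℚ-+ : ∀ a b → ℕtoℚ (a ℕ.+ b) ≡ ℕtoℚ a + ℕtoℚ b
ℕtoℚ-+ a b rewrite ℕtoℚ≡mkℚ a | ℕtoℚ≡mkℚ b =
  cong (_/ 1) (sym (cong₂ ℤ._+_ (ℤP.*-identityʳ (+ a)) (ℤP.*-identityʳ (+ b))))

ℕtoℚ-* : ∀ a b → ℕtoℚ (a ℕ.* b) ≡ ℕtoℚ a * ℕtoℚ b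
ℕtoℚ-* a b rewrite ℕtoℚ≡mkℚ a | ℕtoℚ≡mkℚ b = cong (_/ 1) (sym (ℤP.+◃n≡+n (a ℕ.* b)))

ℕtoℚ-double : ∀ n → ℕtoℚ (2 ℕ.* n) ≡ ℕtoℚ n + ℕtoℚ n
ℕtoℚ-double n = trans (ℕtoℚ-+ n (n ℕ.+ 0)) (cong (λ k → ℕtoℚ n + ℕtoℚ k) (ℕP.+-identityʳ n))

ℕtoℚ-∸ : ∀ a b → b ≤ a → ℕtoℚ (a ∸ b) ≡ ℕtoℚ a - ℕtoℚ b
ℕtoℚ-∸ a b b≤a = begin
  ℕtoℚ (a ∸ b)                     ≡⟨ solve 2 (λ x y → x := (x :+ y) :- y) refl (ℕtoℚ (a ∸ b)) (ℕtoℚ b) ⟩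
  (ℕtoℚ (a ∸ b) + ℕtoℚ b) - ℕtoℚ b ≡⟨ cong (_- ℕtoℚ b) (sym (ℕtoℚ-+ (a ∸ b) b)) ⟩
  ℕtoℚ (a ∸ b ℕ.+ b) - ℕtoℚ b      ≡⟨ cong (λ k → ℕtoℚ k - ℕtoℚ b) (ℕP.m∸n+n≡m b≤a) ⟩
  ℕtoℚ a - ℕtoℚ b                  ∎

ℕtoℚ[1+a]-1≡ℕtoℚ[a] : ∀ a → ℕtoℚ (suc a) - 1ℚ ≡ ℕtoℚ a
ℕtoℚ[1+a]-1≡ℕtoℚ[a] a rewrite ℕtoℚ-+ 1 a = solve 1 (λ x → (con 1ℚ :+ x) :- con 1ℚ := x) refl (ℕtoℚ a)

sumTo-cong : ∀ n {f g : ℕ → ℚ} → (∀ i → i < n → f i ≡ g i) → sumTo n f ≡ sumTo n g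
sumTo-cong zero    f≡g = refl
sumTo-cong (suc n) f≡g =
  cong₂ _+_ (sumTo-cong n (λ i i<n → f≡g i (ℕP.m<n⇒m<1+n i<n))) (f≡g n (ℕP.n<1+n n))

sumTo-ext : ∀ n {f g : ℕ → ℚ} → (∀ i → f i ≡ g i) → sumTo n f ≡ sumTo n g
sumTo-ext n f≡g = sumTo-cong n (λ i _ → f≡g i)

sumTo-+ : ∀ n (f g : ℕ → ℚ) → sumTo n (λ i → f i + g i) ≡ sumTo n f + sumTo n g
sumTo-+ zero    f g = refl
sumTo-+ (suc n) f g rewrite sumTo-+ n f g =
  solve 4 (λ a b c d → (a :+ b) :+ (c :+ d) := (a :+ c) :+ (b :+ d)) refl
    (sumTo n f) (sumTo n g) (f n) (g n)

*-sumToˡ : ∀ n c (f : ℕ → ℚ) → c * sumTo n f ≡ sumTo n (λ i → c * f i)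
*-sumToˡ zero    c f = ℚP.*-zeroʳ c
*-sumToˡ (suc n) c f rewrite sym (*-sumToˡ n c f) = ℚP.*-distribˡ-+ c (sumTo n f) (f n)

sumTo-0 : ∀ n → sumTo n (λ _ → 0ℚ) ≡ 0ℚ
sumTo-0 zero    = refl
sumTo-0 (suc n) rewrite sumTo-0 n = refl

sumTo-suc-head : ∀ n (f : ℕ → ℚ) → sumTo (suc n) f ≡ f 0 + sumTo n (λ i → f (suc i))
sumTo-suc-head zero    f = ℚP.+-comm 0ℚ (f 0)
sumTo-suc-head (suc n) f rewrite sumTo-suc-head n f = ℚP.+-assoc (f 0) _ _

sumTo-+-split : ∀ a b (f : ℕ → ℚ) → sumTo (a ℕ.+ b) f ≡ sumTo a f + sumTo b (λ i → f (a ℕ.+ i))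
sumTo-+-split a zero    f rewrite ℕP.+-identityʳ a = sym (ℚP.+-identityʳ _)
sumTo-+-split a (suc b) f rewrite ℕP.+-suc a b | sumTo-+-split a b f =
  ℚP.+-assoc (sumTo a f) _ (f (a ℕ.+ b))

sumTo-reverse : ∀ n (f : ℕ → ℚ) → sumTo n f ≡ sumTo n (λ i → f (n ∸ suc i))
sumTo-reverse zero    f = refl
sumTo-reverse (suc n) f rewrite sumTo-reverse n f | sumTo-suc-head n (λ i → f (n ∸ i)) =
  ℚP.+-comm (sumTo n (λ i → f (n ∸ suc i))) (f n)

sumTo-swap : ∀ a b (f : ℕ → ℕ → ℚ) →
  sumTo a (λ i → sumTo b (λ j → f i j)) ≡ sumTo b (λ j → sumTo a (λ i → f i j))
sumTo-swap zero    b f = sym (sumTo-0 b)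
sumTo-swap (suc a) b f rewrite sumTo-swap a b f =
  sym (sumTo-+ b (λ j → sumTo a (λ i → f i j)) (λ j → f a j))

sumTo-around-centre : ∀ n (f : ℕ → ℚ) →
  sumTo (suc (2 ℕ.* n)) f ≡ sumTo n (λ i → f (n ∸ suc i)) + (f n + sumTo n (λ i → f (n ℕ.+ suc i)))
sumTo-around-centre n f = begin
  sumTo (suc (2 ℕ.* n)) f
    ≡⟨ cong (λ k → sumTo k f) 2n+1≡n+[n+1] ⟩
  sumTo (n ℕ.+ suc n) f
    ≡⟨ sumTo-+-split n (suc n) f ⟩
  sumTo n f + sumTo (suc n) (λ i → f (n ℕ.+ i))
    ≡⟨ cong₂ _+_ (sumTo-reverse n f) (sumTo-suc-head n (λ i → f (n ℕ.+ i))) ⟩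
  sumTo n (λ i → f (n ∸ suc i)) + (f (n ℕ.+ 0) + sumTo n (λ i → f (n ℕ.+ suc i)))
    ≡⟨ cong (λ k → sumTo n (λ i → f (n ∸ suc i)) + (f k + sumTo n (λ i → f (n ℕ.+ suc i))))
            (ℕP.+-identityʳ n) ⟩
  sumTo n (λ i → f (n ∸ suc i)) + (f n + sumTo n (λ i → f (n ℕ.+ suc i))) ∎
  where
  2n+1≡n+[n+1] : suc (2 ℕ.* n) ≡ n ℕ.+ suc n
  2n+1≡n+[n+1] = trans (cong (λ k → suc (n ℕ.+ k)) (ℕP.+-identityʳ n)) (sym (ℕP.+-suc n n))

^ℚ-square : ∀ x m → (x * x) ^ℚ m ≡ x ^ℚ (2 ℕ.* m)
^ℚ-square x zero    = refl
^ℚ-square x (suc m) = begin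
  (x * x) * (x * x) ^ℚ m  ≡⟨ cong ((x * x) *_) (^ℚ-square x m) ⟩
  (x * x) * x ^ℚ (2 ℕ.* m) ≡⟨ ℚP.*-assoc x x (x ^ℚ (2 ℕ.* m)) ⟩
  x ^ℚ suc (suc (2 ℕ.* m)) ≡⟨ cong (x ^ℚ_) (sym (ℕP.*-suc 2 m)) ⟩
  x ^ℚ (2 ℕ.* suc m)       ∎

pow2-pred : ∀ e → pow2 e ≡ ℕtoℚ 2 * pow2 (e ℤ.- + 1)
pow2-pred (+ zero)  = refl
pow2-pred (+ suc k) = refl
pow2-pred -[1+ k ] rewrite ℕP.+-identityʳ k =
  sym (trans (sym (ℚP.*-assoc (ℕtoℚ 2) ½ (½ ^ℚ suc k))) (ℚP.*-identityˡ (½ ^ℚ suc k)))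
  where ½ = + 1 / 2

pow2-exponent-step : ∀ N l → + suc (suc N) ℤ.- + (2 ℕ.* suc l) ≡ + N ℤ.- + (2 ℕ.* l)
pow2-exponent-step N l = begin
  + suc (suc N) ℤ.- + (2 ℕ.* suc l)           ≡⟨ cong (λ k → + suc (suc N) ℤ.- + k) (ℕP.*-suc 2 l) ⟩
  + suc (suc N) ℤ.- + suc (suc (2 ℕ.* l))     ≡⟨ ℤP.[+m]-[+n]≡m⊖n (suc (suc N)) (suc (suc (2 ℕ.* l))) ⟩
  suc (suc N) ℤ.⊖ suc (suc (2 ℕ.* l))         ≡⟨ ℤP.[1+m]⊖[1+n]≡m⊖n (suc N) (suc (2 ℕ.* l)) ⟩
  suc N ℤ.⊖ suc (2 ℕ.* l)                     ≡⟨ ℤP.[1+m]⊖[1+n]≡m⊖n N (2 ℕ.* l) ⟩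
  N ℤ.⊖ (2 ℕ.* l)                             ≡⟨ sym (ℤP.[+m]-[+n]≡m⊖n N (2 ℕ.* l)) ⟩
  + N ℤ.- + (2 ℕ.* l)                         ∎

falling-suc : ∀ x l → falling x (suc l) ≡ x * falling (x - 1ℚ) l
falling-suc x zero    = solve 1 (λ x → con 1ℚ :* (x :- con 0ℚ) := x :* con 1ℚ) refl x
falling-suc x (suc l) rewrite falling-suc x l | ℕtoℚ-+ 1 l =
  solve 3 (λ x F L → x :* F :* (x :- (con 1ℚ :+ L)) := x :* (F :* ((x :- con 1ℚ) :- L))) refl
    x (falling (x - 1ℚ) l) (ℕtoℚ l)

falling-suc-suc : ∀ N l →
  falling (ℕtoℚ (suc (suc N))) (2 ℕ.* suc l) ≡ ℕtoℚ (suc (suc N)) * ℕtoℚ (suc N) * falling (ℕtoℚ N) (2 ℕ.* l)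
falling-suc-suc N l = begin
  falling (ℕtoℚ (suc (suc N))) (2 ℕ.* suc l)
    ≡⟨ cong (falling (ℕtoℚ (suc (suc N)))) (ℕP.*-suc 2 l) ⟩
  falling (ℕtoℚ (suc (suc N))) (suc (suc (2 ℕ.* l)))
    ≡⟨ falling-suc (ℕtoℚ (suc (suc N))) (suc (2 ℕ.* l)) ⟩
  ℕtoℚ (suc (suc N)) * falling (ℕtoℚ (suc (suc N)) - 1ℚ) (suc (2 ℕ.* l))
    ≡⟨ cong (λ x → ℕtoℚ (suc (suc N)) * falling x (suc (2 ℕ.* l))) (ℕtoℚ[1+a]-1≡ℕtoℚ[a] (suc N)) ⟩
  ℕtoℚ (suc (suc N)) * falling (ℕtoℚ (suc N)) (suc (2 ℕ.* l))
    ≡⟨ cong (ℕtoℚ (suc (suc N)) *_) (falling-suc (ℕtoℚ (suc N)) (2 ℕ.* l)) ⟩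
  ℕtoℚ (suc (suc N)) * (ℕtoℚ (suc N) * falling (ℕtoℚ (suc N) - 1ℚ) (2 ℕ.* l))
    ≡⟨ cong (λ x → ℕtoℚ (suc (suc N)) * (ℕtoℚ (suc N) * falling x (2 ℕ.* l))) (ℕtoℚ[1+a]-1≡ℕtoℚ[a] N) ⟩
  ℕtoℚ (suc (suc N)) * (ℕtoℚ (suc N) * falling (ℕtoℚ N) (2 ℕ.* l))
    ≡⟨ sym (ℚP.*-assoc (ℕtoℚ (suc (suc N))) (ℕtoℚ (suc N)) _) ⟩
  ℕtoℚ (suc (suc N)) * ℕtoℚ (suc N) * falling (ℕtoℚ N) (2 ℕ.* l) ∎

falling-ℕ-vanish : ∀ i l → i < l → falling (ℕtoℚ i) l ≡ 0ℚ
falling-ℕ-vanish i (suc l) i<1+l with ℕP.m<1+n⇒m<n∨m≡n i<1+l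
... | inj₁ i<l  rewrite falling-ℕ-vanish i l i<l = ℚP.*-zeroˡ (ℕtoℚ i - ℕtoℚ l)
... | inj₂ refl rewrite ℚP.+-inverseʳ (ℕtoℚ i) = ℚP.*-zeroʳ (falling (ℕtoℚ i) i)

falling-zero-suc : ∀ l → falling 0ℚ (suc l) ≡ 0ℚ
falling-zero-suc l = falling-ℕ-vanish 0 (suc l) (s≤s z≤n)

binomial-sum : ∀ N → sumTo (suc N) (λ i → ℕtoℚ (N C i)) ≡ pow2 (+ N)
binomial-sum zero    = refl
binomial-sum (suc N) = begin
  sumTo (suc (suc N)) (λ i → ℕtoℚ (suc N C i))
    ≡⟨ sumTo-suc-head (suc N) _ ⟩
  1ℚ + sumTo (suc N) (λ i → ℕtoℚ (suc N C suc i))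
    ≡⟨ cong (λ s → 1ℚ + s) (sumTo-ext (suc N) pascal) ⟩
  1ℚ + sumTo (suc N) (λ i → ℕtoℚ (N C i) + ℕtoℚ (N C suc i))
    ≡⟨ cong (λ s → 1ℚ + s) (sumTo-+ (suc N) _ _) ⟩
  1ℚ + (sumTo (suc N) (λ i → ℕtoℚ (N C i)) + (S + ℕtoℚ (N C suc N)))
    ≡⟨ cong₂ (λ a b → 1ℚ + (a + (S + ℕtoℚ b))) (sumTo-suc-head N _) (k>n⇒nCk≡0 (ℕP.n<1+n N)) ⟩
  1ℚ + ((1ℚ + S) + (S + 0ℚ))
    ≡⟨ solve 1 (λ S → con 1ℚ :+ ((con 1ℚ :+ S) :+ (S :+ con 0ℚ)) := con (ℕtoℚ 2) :* (con 1ℚ :+ S)) refl S ⟩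
  ℕtoℚ 2 * (1ℚ + S)
    ≡⟨ cong (ℕtoℚ 2 *_) (trans (sym (sumTo-suc-head N _)) (binomial-sum N)) ⟩
  ℕtoℚ 2 * pow2 (+ N) ∎
  where
  S = sumTo N (λ i → ℕtoℚ (N C suc i))
  pascal : ∀ i → ℕtoℚ (suc N C suc i) ≡ ℕtoℚ (N C i) + ℕtoℚ (N C suc i)
  pascal i = trans (cong ℕtoℚ (sym (nCk+nC[k+1]≡[n+1]C[k+1] N i))) (ℕtoℚ-+ (N C i) (N C suc i))

suc-*-C : ∀ n k → suc k ℕ.* (suc n C suc k) ≡ suc n ℕ.* (n C k)
suc-*-C zero    zero    = refl
suc-*-C zero    (suc k)
  rewrite k>n⇒nCk≡0 {1} {suc (suc k)} (s≤s (s≤s z≤n)) | k>n⇒nCk≡0 {0} {suc k} (s≤s z≤n) =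
  ℕP.*-zeroʳ (suc (suc k))
suc-*-C (suc n) zero    rewrite nC1≡n (suc (suc n)) | ℕP.*-identityʳ n = ℕP.+-identityʳ _
suc-*-C (suc n) (suc k) = begin
  suc (suc k) ℕ.* (suc (suc n) C suc (suc k))
    ≡⟨ cong (suc (suc k) ℕ.*_) (sym (nCk+nC[k+1]≡[n+1]C[k+1] (suc n) (suc k))) ⟩
  suc (suc k) ℕ.* ((suc n C suc k) ℕ.+ (suc n C suc (suc k)))
    ≡⟨ ℕP.*-distribˡ-+ (suc (suc k)) (suc n C suc k) _ ⟩
  ((suc n C suc k) ℕ.+ suc k ℕ.* (suc n C suc k)) ℕ.+ suc (suc k) ℕ.* (suc n C suc (suc k))
    ≡⟨ ℕP.+-assoc (suc n C suc k) _ _ ⟩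
  (suc n C suc k) ℕ.+ (suc k ℕ.* (suc n C suc k) ℕ.+ suc (suc k) ℕ.* (suc n C suc (suc k)))
    ≡⟨ cong₂ (λ a b → (suc n C suc k) ℕ.+ (a ℕ.+ b)) (suc-*-C n k) (suc-*-C n (suc k)) ⟩
  (suc n C suc k) ℕ.+ (suc n ℕ.* (n C k) ℕ.+ suc n ℕ.* (n C suc k))
    ≡⟨ cong ((suc n C suc k) ℕ.+_) (sym (ℕP.*-distribˡ-+ (suc n) (n C k) (n C suc k))) ⟩
  (suc n C suc k) ℕ.+ suc n ℕ.* ((n C k) ℕ.+ (n C suc k))
    ≡⟨ cong (λ c → (suc n C suc k) ℕ.+ suc n ℕ.* c) (nCk+nC[k+1]≡[n+1]C[k+1] n k) ⟩
  suc (suc n) ℕ.* (suc n C suc k) ∎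

C-*-∸ : ∀ n k → k ≤ n → (suc n C k) ℕ.* (suc n ∸ k) ≡ suc n ℕ.* (n C k)
C-*-∸ n k k≤n = begin
  (suc n C k) ℕ.* (suc n ∸ k)                   ≡⟨ cong₂ ℕ._*_ (nCk≡nC[n∸k] (ℕP.m≤n⇒m≤1+n k≤n)) 1+n∸k≡1+[n∸k] ⟩
  (suc n C (suc n ∸ k)) ℕ.* suc (n ∸ k)          ≡⟨ cong (λ j → (suc n C j) ℕ.* suc (n ∸ k)) 1+n∸k≡1+[n∸k] ⟩
  (suc n C suc (n ∸ k)) ℕ.* suc (n ∸ k)          ≡⟨ ℕP.*-comm (suc n C suc (n ∸ k)) (suc (n ∸ k)) ⟩
  suc (n ∸ k) ℕ.* (suc n C suc (n ∸ k))          ≡⟨ suc-*-C n (n ∸ k) ⟩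
  suc n ℕ.* (n C (n ∸ k))                        ≡⟨ cong (suc n ℕ.*_) (sym (nCk≡nC[n∸k] k≤n)) ⟩
  suc n ℕ.* (n C k)                              ∎
  where
  1+n∸k≡1+[n∸k] : suc n ∸ k ≡ suc (n ∸ k)
  1+n∸k≡1+[n∸k] = ℕP.+-∸-assoc 1 k≤n

C-*-suc-*-∸ : ∀ n k → k ≤ n →
  (suc (suc n) C suc k) ℕ.* suc k ℕ.* (suc n ∸ k) ≡ suc (suc n) ℕ.* suc n ℕ.* (n C k)
C-*-suc-*-∸ n k k≤n = begin
  (suc (suc n) C suc k) ℕ.* suc k ℕ.* (suc n ∸ k)
    ≡⟨ cong (ℕ._* (suc n ∸ k)) (ℕP.*-comm (suc (suc n) C suc k) (suc k)) ⟩
  suc k ℕ.* (suc (suc n) C suc k) ℕ.* (suc n ∸ k)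
    ≡⟨ cong (ℕ._* (suc n ∸ k)) (suc-*-C (suc n) k) ⟩
  suc (suc n) ℕ.* (suc n C k) ℕ.* (suc n ∸ k)
    ≡⟨ ℕP.*-assoc (suc (suc n)) (suc n C k) (suc n ∸ k) ⟩
  suc (suc n) ℕ.* ((suc n C k) ℕ.* (suc n ∸ k))
    ≡⟨ cong (suc (suc n) ℕ.*_) (C-*-∸ n k k≤n) ⟩
  suc (suc n) ℕ.* (suc n ℕ.* (n C k))
    ≡⟨ sym (ℕP.*-assoc (suc (suc n)) (suc n) (n C k)) ⟩
  suc (suc n) ℕ.* suc n ℕ.* (n C k) ∎

binomialFallingTerm : ℕ → ℕ → ℕ → ℚ
binomialFallingTerm N l i = ℕtoℚ (N C i) * falling (ℕtoℚ i) l * falling (ℕtoℚ N - ℕtoℚ i) l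

binomialFallingSum : ℕ → ℕ → ℚ
binomialFallingSum N l = sumTo (suc N) (binomialFallingTerm N l)

binomialFallingTerm-first : ∀ N l → binomialFallingTerm N (suc l) 0 ≡ 0ℚ
binomialFallingTerm-first N l
  rewrite falling-zero-suc l =
  solve 2 (λ c x → c :* con 0ℚ :* x := con 0ℚ) refl (ℕtoℚ (N C 0)) (falling (ℕtoℚ N - 0ℚ) (suc l))

binomialFallingTerm-last : ∀ N l → binomialFallingTerm N (suc l) N ≡ 0ℚ
binomialFallingTerm-last N l
  rewrite ℚP.+-inverseʳ (ℕtoℚ N) | falling-zero-suc l = ℚP.*-zeroʳ (ℕtoℚ (N C N) * falling (ℕtoℚ N) (suc l))

binomialFallingTerm-step : ∀ M l i → i ≤ M →
  binomialFallingTerm (suc (suc M)) (suc l) (suc i)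
    ≡ ℕtoℚ (suc (suc M)) * ℕtoℚ (suc M) * binomialFallingTerm M l i
binomialFallingTerm-step M l i i≤M = begin
  ℕtoℚ (N C suc i) * falling (ℕtoℚ (suc i)) (suc l) * falling (ℕtoℚ N - ℕtoℚ (suc i)) (suc l)
    ≡⟨ cong₂ (λ p q → ℕtoℚ (N C suc i) * p * q) left right ⟩
  ℕtoℚ (N C suc i) * (ℕtoℚ (suc i) * F₁) * (ℕtoℚ (suc M ∸ i) * F₂)
    ≡⟨ solve 5 (λ c a b x y → c :* (a :* x) :* (b :* y) := (c :* a :* b) :* (x :* y)) refl
         (ℕtoℚ (N C suc i)) (ℕtoℚ (suc i)) (ℕtoℚ (suc M ∸ i)) F₁ F₂ ⟩
  ℕtoℚ (N C suc i) * ℕtoℚ (suc i) * ℕtoℚ (suc M ∸ i) * (F₁ * F₂)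
    ≡⟨ cong (_* (F₁ * F₂)) coefficient ⟩
  ℕtoℚ N * ℕtoℚ (suc M) * ℕtoℚ (M C i) * (F₁ * F₂)
    ≡⟨ solve 5 (λ a b c x y → a :* b :* c :* (x :* y) := a :* b :* (c :* x :* y)) refl
         (ℕtoℚ N) (ℕtoℚ (suc M)) (ℕtoℚ (M C i)) F₁ F₂ ⟩
  ℕtoℚ N * ℕtoℚ (suc M) * binomialFallingTerm M l i ∎
  where
  N = suc (suc M)
  F₁ = falling (ℕtoℚ i) l
  F₂ = falling (ℕtoℚ M - ℕtoℚ i) l

  left : falling (ℕtoℚ (suc i)) (suc l) ≡ ℕtoℚ (suc i) * F₁
  left = trans (falling-suc (ℕtoℚ (suc i)) l)
               (cong (λ x → ℕtoℚ (suc i) * falling x l) (ℕtoℚ[1+a]-1≡ℕtoℚ[a] i))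

  shifted : (ℕtoℚ N - ℕtoℚ (suc i)) - 1ℚ ≡ ℕtoℚ M - ℕtoℚ i
  shifted rewrite ℕtoℚ-+ 1 (suc M) | ℕtoℚ-+ 1 M | ℕtoℚ-+ 1 i =
    solve 2 (λ m x → ((con 1ℚ :+ (con 1ℚ :+ m)) :- (con 1ℚ :+ x)) :- con 1ℚ := m :- x) refl
      (ℕtoℚ M) (ℕtoℚ i)

  right : falling (ℕtoℚ N - ℕtoℚ (suc i)) (suc l) ≡ ℕtoℚ (suc M ∸ i) * F₂
  right = trans (falling-suc (ℕtoℚ N - ℕtoℚ (suc i)) l)
                (cong₂ (λ x z → x * falling z l)
                       (sym (ℕtoℚ-∸ N (suc i) (s≤s (ℕP.m≤n⇒m≤1+n i≤M)))) shifted)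

  ℕtoℚ-*₃ : ∀ a b c → ℕtoℚ (a ℕ.* b ℕ.* c) ≡ ℕtoℚ a * ℕtoℚ b * ℕtoℚ c
  ℕtoℚ-*₃ a b c = trans (ℕtoℚ-* (a ℕ.* b) c) (cong (_* ℕtoℚ c) (ℕtoℚ-* a b))

  coefficient : ℕtoℚ (N C suc i) * ℕtoℚ (suc i) * ℕtoℚ (suc M ∸ i) ≡ ℕtoℚ N * ℕtoℚ (suc M) * ℕtoℚ (M C i)
  coefficient = begin
    ℕtoℚ (N C suc i) * ℕtoℚ (suc i) * ℕtoℚ (suc M ∸ i) ≡⟨ sym (ℕtoℚ-*₃ (N C suc i) (suc i) (suc M ∸ i)) ⟩
    ℕtoℚ ((N C suc i) ℕ.* suc i ℕ.* (suc M ∸ i))        ≡⟨ cong ℕtoℚ (C-*-suc-*-∸ M i i≤M) ⟩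
    ℕtoℚ (N ℕ.* suc M ℕ.* (M C i))                      ≡⟨ ℕtoℚ-*₃ N (suc M) (M C i) ⟩
    ℕtoℚ N * ℕtoℚ (suc M) * ℕtoℚ (M C i)                ∎

binomialFallingSum-step : ∀ M l →
  binomialFallingSum (suc (suc M)) (suc l) ≡ ℕtoℚ (suc (suc M)) * ℕtoℚ (suc M) * binomialFallingSum M l
binomialFallingSum-step M l = begin
  sumTo (suc (suc (suc M))) f
    ≡⟨ sumTo-suc-head (suc (suc M)) f ⟩
  f 0 + (sumTo (suc M) (λ i → f (suc i)) + f (suc (suc M)))
    ≡⟨ cong₂ (λ a b → a + (sumTo (suc M) (λ i → f (suc i)) + b))
             (binomialFallingTerm-first (suc (suc M)) l) (binomialFallingTerm-last (suc (suc M)) l) ⟩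
  0ℚ + (sumTo (suc M) (λ i → f (suc i)) + 0ℚ)
    ≡⟨ trans (ℚP.+-identityˡ _) (ℚP.+-identityʳ _) ⟩
  sumTo (suc M) (λ i → f (suc i))
    ≡⟨ sumTo-cong (suc M) (λ i i<1+M → binomialFallingTerm-step M l i (ℕP.≤-pred i<1+M)) ⟩
  sumTo (suc M) (λ i → K * binomialFallingTerm M l i)
    ≡⟨ sym (*-sumToˡ (suc M) K (binomialFallingTerm M l)) ⟩
  K * binomialFallingSum M l ∎
  where
  f = binomialFallingTerm (suc (suc M)) (suc l)
  K = ℕtoℚ (suc (suc M)) * ℕtoℚ (suc M)

N<2⇒falling[N]*pow2≡0 : ∀ N l → N < 2 →
  falling (ℕtoℚ N) (2 ℕ.* suc l) * pow2 (+ N ℤ.- + (2 ℕ.* suc l)) ≡ 0ℚ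
N<2⇒falling[N]*pow2≡0 N l N<2 = begin
  falling (ℕtoℚ N) (2 ℕ.* suc l) * pow2 e ≡⟨ cong (_* pow2 e) (falling-ℕ-vanish N (2 ℕ.* suc l) N<2l+2) ⟩
  0ℚ * pow2 e                              ≡⟨ ℚP.*-zeroˡ (pow2 e) ⟩
  0ℚ                                       ∎
  where
  e = + N ℤ.- + (2 ℕ.* suc l)
  N<2l+2 : N < 2 ℕ.* suc l
  N<2l+2 = ℕP.<-≤-trans N<2 (ℕP.*-monoʳ-≤ 2 (s≤s z≤n))

binomialFallingSum-closed : ∀ N l →
  binomialFallingSum N l ≡ falling (ℕtoℚ N) (2 ℕ.* l) * pow2 (+ N ℤ.- + (2 ℕ.* l))
binomialFallingSum-closed N zero = begin
  binomialFallingSum N 0                  ≡⟨ sumTo-ext (suc N) (λ i → trans (ℚP.*-identityʳ _) (ℚP.*-identityʳ _)) ⟩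
  sumTo (suc N) (λ i → ℕtoℚ (N C i))      ≡⟨ binomial-sum N ⟩
  pow2 (+ N)                              ≡⟨ sym (ℚP.*-identityˡ _) ⟩
  1ℚ * pow2 (+ N)                         ≡⟨ cong (λ k → 1ℚ * pow2 (+ k)) (sym (ℕP.+-identityʳ N)) ⟩
  1ℚ * pow2 (+ (N ℕ.+ 0))                 ∎
binomialFallingSum-closed zero (suc l) =
  trans (cong (λ t → 0ℚ + t) (binomialFallingTerm-first 0 l))
        (sym (N<2⇒falling[N]*pow2≡0 0 l (s≤s z≤n)))
binomialFallingSum-closed (suc zero) (suc l) =
  trans (cong₂ (λ s t → (0ℚ + s) + t) (binomialFallingTerm-first 1 l) (binomialFallingTerm-last 1 l))
        (sym (N<2⇒falling[N]*pow2≡0 1 l (s≤s (s≤s z≤n))))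
binomialFallingSum-closed (suc (suc M)) (suc l) = begin
  binomialFallingSum (suc (suc M)) (suc l)
    ≡⟨ binomialFallingSum-step M l ⟩
  K * binomialFallingSum M l
    ≡⟨ cong (K *_) (binomialFallingSum-closed M l) ⟩
  K * (falling (ℕtoℚ M) (2 ℕ.* l) * pow2 (+ M ℤ.- + (2 ℕ.* l)))
    ≡⟨ sym (ℚP.*-assoc K _ _) ⟩
  K * falling (ℕtoℚ M) (2 ℕ.* l) * pow2 (+ M ℤ.- + (2 ℕ.* l))
    ≡⟨ cong₂ _*_ (sym (falling-suc-suc M l)) (cong pow2 (sym (pow2-exponent-step M l))) ⟩
  falling (ℕtoℚ (suc (suc M))) (2 ℕ.* suc l) * pow2 (+ suc (suc M) ℤ.- + (2 ℕ.* suc l)) ∎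
  where
  K = ℕtoℚ (suc (suc M)) * ℕtoℚ (suc M)

hcomp-∷ʳ : ∀ d xs x → hcomp (suc d) (xs ++ [ x ]) ≡ hcomp (suc d) xs + x * hcomp d (xs ++ [ x ])
hcomp-∷ʳ d       []       y = refl
hcomp-∷ʳ zero    (x ∷ xs) y rewrite hcomp-∷ʳ zero xs y | ℚP.*-identityʳ x | ℚP.*-identityʳ y =
  solve 3 (λ h x y → (h :+ y) :+ x := (h :+ x) :+ y) refl (hcomp 1 xs) x y
hcomp-∷ʳ (suc d) (x ∷ xs) y =
  trans (cong₂ (λ p q → p + x * q) (hcomp-∷ʳ (suc d) xs y) (hcomp-∷ʳ d (x ∷ xs) y))
        (solve 6 (λ h x y g k j → (h :+ y :* g) :+ x :* (k :+ y :* j) := (h :+ x :* k) :+ y :* (g :+ x :* j)) refl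
           (hcomp (suc (suc d)) xs) x y (hcomp (suc d) (xs ++ [ y ])) (hcomp (suc d) (x ∷ xs))
           (hcomp d (x ∷ xs ++ [ y ])))

nodes : (ℕ → ℚ) → ℕ → List ℚ
nodes a k = map a (upTo k)

nodes-suc : ∀ a k → nodes a (suc k) ≡ nodes a k ++ [ a k ]
nodes-suc a k = trans (cong (map a) (sym (ListP.upTo-∷ʳ k))) (ListP.map-++ a (upTo k) [ k ])

hcomp-nodes-suc : ∀ a d k →
  hcomp (suc d) (nodes a (suc k)) ≡ hcomp (suc d) (nodes a k) + a k * hcomp d (nodes a (suc k))
hcomp-nodes-suc a d k = begin
  hcomp (suc d) (nodes a (suc k))
    ≡⟨ cong (hcomp (suc d)) (nodes-suc a k) ⟩
  hcomp (suc d) (nodes a k ++ [ a k ])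
    ≡⟨ hcomp-∷ʳ d (nodes a k) (a k) ⟩
  hcomp (suc d) (nodes a k) + a k * hcomp d (nodes a k ++ [ a k ])
    ≡⟨ cong (λ xs → hcomp (suc d) (nodes a k) + a k * hcomp d xs) (sym (nodes-suc a k)) ⟩
  hcomp (suc d) (nodes a k) + a k * hcomp d (nodes a (suc k)) ∎

-- hcomp (m ∸ l) (a₀, …, a_l) is the divided difference of x ↦ x ^ m at the nodes a₀, …, a_l.
powDividedDifference : (ℕ → ℚ) → ℕ → ℕ → ℚ
powDividedDifference a m l = hcomp (m ∸ l) (nodes a (suc l))

newtonBasis : (ℕ → ℚ) → ℚ → ℕ → ℚ
newtonBasis a u zero    = 1ℚ
newtonBasis a u (suc l) = newtonBasis a u l * (u - a l)

module _ (a : ℕ → ℚ) (u : ℚ) where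
  private
    δ = powDividedDifference a
    P = newtonBasis a u

  powDividedDifference-diag : ∀ m → δ m m ≡ 1ℚ
  powDividedDifference-diag m = cong (λ k → hcomp k (nodes a (suc m))) (ℕP.n∸n≡0 m)

  powDividedDifference-suc : ∀ m l → l ≤ m → δ (suc m) l ≡ hcomp (suc (m ∸ l)) (nodes a l) + a l * δ m l
  powDividedDifference-suc m l l≤m =
    trans (cong (λ k → hcomp k (nodes a (suc l))) (ℕP.+-∸-assoc 1 l≤m)) (hcomp-nodes-suc a (m ∸ l) l)

  private
    sumTo-lowered : ∀ m →
      sumTo (suc m) (λ l → hcomp (suc (m ∸ l)) (nodes a l) * P l) ≡ sumTo m (λ l → δ m l * P (suc l))
    sumTo-lowered m =
      trans (sumTo-suc-head m _)
      (trans (ℚP.+-identityˡ _)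
      (sumTo-cong m (λ l l<m → cong (λ k → hcomp k (nodes a (suc l)) * P (suc l)) (sym (ℕP.+-∸-assoc 1 l<m)))))

  -- u · P_l = P_{l+1} + a_l · P_l, and the two resulting sums recombine by the recursion
  -- h_{d+1}(a₀, …, a_l) = h_{d+1}(a₀, …, a_{l−1}) + a_l · h_d(a₀, …, a_l).
  pow-newtonExpansion : ∀ m → u ^ℚ m ≡ sumTo (suc m) (λ l → powDividedDifference a m l * newtonBasis a u l)
  pow-newtonExpansion zero    = refl
  pow-newtonExpansion (suc m) = begin
    u * u ^ℚ m
      ≡⟨ cong (u *_) (pow-newtonExpansion m) ⟩
    u * sumTo (suc m) (λ l → δ m l * P l)
      ≡⟨ *-sumToˡ (suc m) u _ ⟩
    sumTo (suc m) (λ l → u * (δ m l * P l))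
      ≡⟨ sumTo-ext (suc m) (λ l → solve 4 (λ u d p x → u :* (d :* p) := d :* (p :* (u :- x)) :+ x :* d :* p)
                                         refl u (δ m l) (P l) (a l)) ⟩
    sumTo (suc m) (λ l → δ m l * P (suc l) + a l * δ m l * P l)
      ≡⟨ sumTo-+ (suc m) _ _ ⟩
    (sumTo m (λ l → δ m l * P (suc l)) + δ m m * P (suc m)) + A
      ≡⟨ cong₂ (λ s d → (s + d * P (suc m)) + A) (sym (sumTo-lowered m)) (powDividedDifference-diag m) ⟩
    (H + 1ℚ * P (suc m)) + A
      ≡⟨ solve 3 (λ h p x → (h :+ p) :+ x := (h :+ x) :+ p) refl H (1ℚ * P (suc m)) A ⟩
    (H + A) + 1ℚ * P (suc m)
      ≡⟨ cong₂ _+_ (sym (sumTo-+ (suc m) _ _)) (cong (_* P (suc m)) (sym (powDividedDifference-diag (suc m)))) ⟩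
    sumTo (suc m) (λ l → hcomp (suc (m ∸ l)) (nodes a l) * P l + a l * δ m l * P l) + δ (suc m) (suc m) * P (suc m)
      ≡⟨ cong (_+ δ (suc m) (suc m) * P (suc m)) (sumTo-cong (suc m) recombine) ⟩
    sumTo (suc m) (λ l → δ (suc m) l * P l) + δ (suc m) (suc m) * P (suc m) ∎
    where
    A = sumTo (suc m) (λ l → a l * δ m l * P l)
    H = sumTo (suc m) (λ l → hcomp (suc (m ∸ l)) (nodes a l) * P l)
    recombine : ∀ l → l < suc m → hcomp (suc (m ∸ l)) (nodes a l) * P l + a l * δ m l * P l ≡ δ (suc m) l * P l
    recombine l l<1+m =
      trans (solve 4 (λ h x d p → h :* p :+ x :* d :* p := (h :+ x :* d) :* p) refl
               (hcomp (suc (m ∸ l)) (nodes a l)) (a l) (δ m l) (P l))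
            (cong (_* P l) (sym (powDividedDifference-suc m l (ℕP.≤-pred l<1+m))))

sqDist : ℕ → ℕ → ℚ
sqDist n j = (ℕtoℚ n - ℕtoℚ j) * (ℕtoℚ n - ℕtoℚ j)

sqDist-self : ∀ n → sqDist n n ≡ 0ℚ
sqDist-self n rewrite ℚP.+-inverseʳ (ℕtoℚ n) = refl

sqDist-below : ∀ n k → k ≤ n → sqDist n (n ∸ k) ≡ ℕtoℚ k * ℕtoℚ k
sqDist-below n k k≤n =
  trans (cong (λ z → (ℕtoℚ n - z) * (ℕtoℚ n - z)) (ℕtoℚ-∸ n k k≤n))
        (solve 2 (λ y s → (y :- (y :- s)) :* (y :- (y :- s)) := s :* s) refl (ℕtoℚ n) (ℕtoℚ k))

sqDist-above : ∀ n k → sqDist n (n ℕ.+ k) ≡ ℕtoℚ k * ℕtoℚ k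
sqDist-above n k =
  trans (cong (λ z → (ℕtoℚ n - z) * (ℕtoℚ n - z)) (ℕtoℚ-+ n k))
        (solve 2 (λ y s → (y :- (y :+ s)) :* (y :- (y :+ s)) := s :* s) refl (ℕtoℚ n) (ℕtoℚ k))

[2n]C[n+k]≡[2n]C[n∸k] : ∀ n k → k ≤ n → (2 ℕ.* n) C (n ℕ.+ k) ≡ (2 ℕ.* n) C (n ∸ k)
[2n]C[n+k]≡[2n]C[n∸k] n k k≤n = begin
  (2 ℕ.* n) C (n ℕ.+ k)                    ≡⟨ nCk≡nC[n∸k] n+k≤2n ⟩
  (2 ℕ.* n) C (n ℕ.+ (n ℕ.+ 0) ∸ (n ℕ.+ k)) ≡⟨ cong ((2 ℕ.* n) C_) (ℕP.[m+n]∸[m+o]≡n∸o n (n ℕ.+ 0) k) ⟩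
  (2 ℕ.* n) C (n ℕ.+ 0 ∸ k)                ≡⟨ cong (λ j → (2 ℕ.* n) C (j ∸ k)) (ℕP.+-identityʳ n) ⟩
  (2 ℕ.* n) C (n ∸ k)                      ∎
  where
  n+k≤2n : n ℕ.+ k ≤ 2 ℕ.* n
  n+k≤2n = ℕP.+-monoʳ-≤ n (subst (k ≤_) (sym (ℕP.+-identityʳ n)) k≤n)

binomialCentralMoment : ℕ → ℕ → ℚ
binomialCentralMoment n m = sumTo (suc (2 ℕ.* n)) (λ i → ℕtoℚ ((2 ℕ.* n) C i) * sqDist n i ^ℚ m)

binomialCentralMoment-halves : ∀ n m →
  binomialCentralMoment n (suc m)
    ≡ sumTo n (λ i → ℕtoℚ ((2 ℕ.* n) C (n ∸ suc i)) * ℕtoℚ (suc i) ^ℚ (2 ℕ.* suc m))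
    + sumTo n (λ i → ℕtoℚ ((2 ℕ.* n) C (n ∸ suc i)) * ℕtoℚ (suc i) ^ℚ (2 ℕ.* suc m))
binomialCentralMoment-halves n m = begin
  sumTo (suc (2 ℕ.* n)) g
    ≡⟨ sumTo-around-centre n g ⟩
  sumTo n (λ i → g (n ∸ suc i)) + (g n + sumTo n (λ i → g (n ℕ.+ suc i)))
    ≡⟨ cong₂ _+_ (sumTo-cong n lower) (cong₂ _+_ centre (sumTo-cong n upper)) ⟩
  half + (0ℚ + half)
    ≡⟨ cong (λ h → half + h) (ℚP.+-identityˡ half) ⟩
  half + half ∎
  where
  g : ℕ → ℚ
  g i = ℕtoℚ ((2 ℕ.* n) C i) * sqDist n i ^ℚ suc m
  term : ℕ → ℚ
  term i = ℕtoℚ ((2 ℕ.* n) C (n ∸ suc i)) * ℕtoℚ (suc i) ^ℚ (2 ℕ.* suc m)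
  half = sumTo n term

  centre : g n ≡ 0ℚ
  centre = trans (cong (λ d → ℕtoℚ ((2 ℕ.* n) C n) * d ^ℚ suc m) (sqDist-self n))
                 (solve 2 (λ c p → c :* (con 0ℚ :* p) := con 0ℚ) refl (ℕtoℚ ((2 ℕ.* n) C n)) (0ℚ ^ℚ m))
  lower : ∀ i → i < n → g (n ∸ suc i) ≡ term i
  lower i i<n = cong (ℕtoℚ ((2 ℕ.* n) C (n ∸ suc i)) *_)
    (trans (cong (_^ℚ suc m) (sqDist-below n (suc i) i<n)) (^ℚ-square (ℕtoℚ (suc i)) (suc m)))
  upper : ∀ i → i < n → g (n ℕ.+ suc i) ≡ term i
  upper i i<n = cong₂ _*_ (cong ℕtoℚ ([2n]C[n+k]≡[2n]C[n∸k] n (suc i) i<n))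
    (trans (cong (_^ℚ suc m) (sqDist-above n (suc i))) (^ℚ-square (ℕtoℚ (suc i)) (suc m)))

newtonBasis-sqDist : ∀ n i l →
  newtonBasis (sqDist n) (sqDist n i) l ≡ sign l * falling (ℕtoℚ i) l * falling (ℕtoℚ (2 ℕ.* n) - ℕtoℚ i) l
newtonBasis-sqDist n i zero    = refl
newtonBasis-sqDist n i (suc l) rewrite newtonBasis-sqDist n i l | ℕtoℚ-double n =
  solve 6 (λ s f g y i l → s :* f :* g :* ((y :- i) :* (y :- i) :- (y :- l) :* (y :- l))
                       := (con (- 1ℚ) :* s) :* (f :* (i :- l)) :* (g :* (((y :+ y) :- i) :- l))) refl
    (sign l) (falling (ℕtoℚ i) l) (falling ((ℕtoℚ n + ℕtoℚ n) - ℕtoℚ i) l) (ℕtoℚ n) (ℕtoℚ i) (ℕtoℚ l)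

binomialCentralMoment-newton : ∀ n m →
  binomialCentralMoment n m ≡ sumTo (suc m) (λ l → σ m l (ℕtoℚ n) * (sign l * binomialFallingSum (2 ℕ.* n) l))
binomialCentralMoment-newton n m = begin
  sumTo (suc N) (λ i → binom i * sqDist n i ^ℚ m)
    ≡⟨ sumTo-ext (suc N) (λ i → cong (binom i *_) (pow-newtonExpansion (sqDist n) (sqDist n i) m)) ⟩
  sumTo (suc N) (λ i → binom i * sumTo (suc m) (λ l → σ m l y * P i l))
    ≡⟨ sumTo-ext (suc N) (λ i → *-sumToˡ (suc m) (binom i) _) ⟩
  sumTo (suc N) (λ i → sumTo (suc m) (λ l → binom i * (σ m l y * P i l)))
    ≡⟨ sumTo-swap (suc N) (suc m) (λ i l → binom i * (σ m l y * P i l)) ⟩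
  sumTo (suc m) (λ l → sumTo (suc N) (λ i → binom i * (σ m l y * P i l)))
    ≡⟨ sumTo-ext (suc m) factor ⟩
  sumTo (suc m) (λ l → σ m l y * (sign l * binomialFallingSum N l)) ∎
  where
  N = 2 ℕ.* n
  y = ℕtoℚ n
  binom : ℕ → ℚ
  binom i = ℕtoℚ (N C i)
  P : ℕ → ℕ → ℚ
  P i = newtonBasis (sqDist n) (sqDist n i)

  factor : ∀ l → sumTo (suc N) (λ i → binom i * (σ m l y * P i l)) ≡ σ m l y * (sign l * binomialFallingSum N l)
  factor l = begin
    sumTo (suc N) (λ i → binom i * (σ m l y * P i l))
      ≡⟨ sumTo-ext (suc N) (λ i → trans (cong (λ p → binom i * (σ m l y * p)) (newtonBasis-sqDist n i l))
           (solve 5 (λ c d s f g → c :* (d :* (s :* f :* g)) := d :* (s :* (c :* f :* g))) refl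
              (binom i) (σ m l y) (sign l) (falling (ℕtoℚ i) l) (falling (ℕtoℚ N - ℕtoℚ i) l))) ⟩
    sumTo (suc N) (λ i → σ m l y * (sign l * binomialFallingTerm N l i))
      ≡⟨ sym (*-sumToˡ (suc N) (σ m l y) _) ⟩
    σ m l y * sumTo (suc N) (λ i → sign l * binomialFallingTerm N l i)
      ≡⟨ cong (σ m l y *_) (sym (*-sumToˡ (suc N) (sign l) (binomialFallingTerm N l))) ⟩
    σ m l y * (sign l * binomialFallingSum N l) ∎

newtonTerm-closed : ∀ n m l →
  σ m l (ℕtoℚ n) * (sign l * binomialFallingSum (2 ℕ.* n) l)
    ≡ ℕtoℚ 2 * (sign l * pow2 (+ (2 ℕ.* n) ℤ.- + (2 ℕ.* l) ℤ.- + 1) * falling (ℕtoℚ (2 ℕ.* n)) (2 ℕ.* l)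
                * σ m l (ℕtoℚ n))
newtonTerm-closed n m l
  rewrite binomialFallingSum-closed (2 ℕ.* n) l | pow2-pred (+ (2 ℕ.* n) ℤ.- + (2 ℕ.* l)) =
  solve 5 (λ d s f t p → d :* (s :* (f :* (t :* p))) := t :* (s :* p :* f :* d)) refl
    (σ m l (ℕtoℚ n)) (sign l) (falling (ℕtoℚ (2 ℕ.* n)) (2 ℕ.* l)) (ℕtoℚ 2)
    (pow2 (+ (2 ℕ.* n) ℤ.- + (2 ℕ.* l) ℤ.- + 1))

2*-injective : ∀ x y → ℕtoℚ 2 * x ≡ ℕtoℚ 2 * y → x ≡ y
2*-injective x y 2x≡2y = begin
  x                  ≡⟨ solve 1 (λ x → x := con ½ :* (con (ℕtoℚ 2) :* x)) refl x ⟩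
  ½ * (ℕtoℚ 2 * x)   ≡⟨ cong (½ *_) 2x≡2y ⟩
  ½ * (ℕtoℚ 2 * y)   ≡⟨ solve 1 (λ y → con ½ :* (con (ℕtoℚ 2) :* y) := y) refl y ⟩
  y                  ∎
  where ½ = + 1 / 2

theorem2 : (m n : ℕ) → 1 ≤ m → 1 ≤ n →
  sumTo n (λ i → ℕtoℚ ((2 ℕ.* n) C (n ∸ suc i)) * (ℕtoℚ (suc i) ^ℚ (2 ℕ.* m)))
    ≡ sumTo (suc m) (λ ℓ → sign ℓ * pow2 (+ (2 ℕ.* n) ℤ.- + (2 ℕ.* ℓ) ℤ.- + 1)
                            * falling (ℕtoℚ (2 ℕ.* n)) (2 ℕ.* ℓ) * σ m ℓ (ℕtoℚ n))
theorem2 (suc m) n _ _ = 2*-injective L (sumTo (suc (suc m)) R) (begin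
  ℕtoℚ 2 * L
    ≡⟨ solve 1 (λ x → con (ℕtoℚ 2) :* x := x :+ x) refl L ⟩
  L + L
    ≡⟨ sym (binomialCentralMoment-halves n m) ⟩
  binomialCentralMoment n (suc m)
    ≡⟨ binomialCentralMoment-newton n (suc m) ⟩
  sumTo (suc (suc m)) (λ l → σ (suc m) l y * (sign l * binomialFallingSum (2 ℕ.* n) l))
    ≡⟨ sumTo-ext (suc (suc m)) (newtonTerm-closed n (suc m)) ⟩
  sumTo (suc (suc m)) (λ l → ℕtoℚ 2 * R l)
    ≡⟨ sym (*-sumToˡ (suc (suc m)) (ℕtoℚ 2) R) ⟩
  ℕtoℚ 2 * sumTo (suc (suc m)) R ∎)
  where
  y = ℕtoℚ n
  L = sumTo n (λ i → ℕtoℚ ((2 ℕ.* n) C (n ∸ suc i)) * ℕtoℚ (suc i) ^ℚ (2 ℕ.* suc m))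
  R : ℕ → ℚ
  R ℓ = sign ℓ * pow2 (+ (2 ℕ.* n) ℤ.- + (2 ℕ.* ℓ) ℤ.- + 1) * falling (ℕtoℚ (2 ℕ.* n)) (2 ℕ.* ℓ) * σ (suc m) ℓ y
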